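{- Let $c>1$ be an integer that occurs as a coordinate of some 3-color fair game, i.e. of some triple of non-negative integers $(x_1,x_2,x_3)$ with $(x_1+x_2+x_3)^2-(x_1+x_2+x_3)-4(x_1x_2+x_1x_3+x_2x_3)=0$. Then the number of 3-color fair games (counted up to permutation of coordinates) having $c$ as their largest coordinate is $2^{m-1}$, where $m$ is the number of distinct prime factors of $2c+1$ other than $3$. -}

module Defs where

open import Data.Nat using (ℕ; zero; suc; _+_; _*_; _≤_; _≤?_; _≟_)
open import Data.Nat.Divisibility using (_∣_; _∣?_)
open import Data.Nat.Primality using (Prime; prime?)
open import Data.List using (List; []; _∷_; length; filter; upTo; concatMap; map)
open import Data.Product using (_×_; _,_; proj₁; proj₂)
open import Relation.Binary.PropositionalEquality using (_≡_; _≢_)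
open import Relation.Nullary using (¬_; Dec; yes; no)
open import Relation.Nullary.Decidable using (_×-dec_; ¬?)

-- (x1,x2,x3) is a 3-color fair game:
--   (x1+x2+x3)^2 - (x1+x2+x3) - 4(x1x2+x1x3+x2x3) = 0,
-- written without subtraction (equivalent over ℕ since all terms are ≥ 0).
FairGame : ℕ → ℕ → ℕ → Set
FairGame x₁ x₂ x₃ =
  let s = x₁ + x₂ + x₃ in
  s * s ≡ s + 4 * (x₁ * x₂ + x₁ * x₃ + x₂ * x₃)

fairGame? : ∀ x₁ x₂ x₃ → Dec (FairGame x₁ x₂ x₃)
fairGame? x₁ x₂ x₃ = _ ≟ _

-- Fair games counted up to permutation with largest coordinate c:
-- sorted representatives (a , b , c) with a ≤ b ≤ c.
sortedPairsUpTo : ℕ → List (ℕ × ℕ)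
sortedPairsUpTo c = concatMap (λ b → map (λ a → (a , b)) (upTo (suc b))) (upTo (suc c))

fairGamesWithMax : ℕ → List (ℕ × ℕ)
fairGamesWithMax c = filter (λ p → fairGame? (proj₁ p) (proj₂ p) c) (sortedPairsUpTo c)

numFairGamesWithMax : ℕ → ℕ
numFairGamesWithMax c = length (fairGamesWithMax c)

-- number of distinct prime factors of n other than 3
-- (every prime divisor of n ≥ 1 lies in 0..n)
numPrimeFactorsNot3 : ℕ → ℕ
numPrimeFactorsNot3 n =
  length (filter (λ p → prime? p ×-dec ((p ∣? n) ×-dec ¬? (p ≟ 3))) (upTo (suc n)))

-- Write a game with largest coordinate c as (a, a + u, c), a + u ≤ c.  Expanding the fairness
-- equation gives (2a + u) N + c = u² + c² with N = 2c + 1, so u is a root of 4x² + 3 modulo N;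
-- conversely a root u ≤ c determines a, because 2a + u = (u² + c²) div N.  The roots modulo N come
-- in pairs x, N − x and 0 is not among them, so the games are counted by half the roots modulo N.
-- That number is multiplicative by the Chinese remainder theorem.  Modulo a power q of a prime
-- p ∤ 6 two roots x ≥ y have q ∣ 4 (x − y)(x + y) with p dividing at most one factor, so there
-- are exactly two of them; and 9 never divides 4x² + 3, so the prime 3 contributes a factor 1.

module Submission where

open import Defs
open import Data.Bool using (Bool; true; false; _∧_; not)
open import Data.Bool.Properties using (∧-identityʳ)
open import Data.Empty using (⊥-elim)
open import Data.List using (List; []; _∷_; length; filter; map; concatMap; applyUpTo; upTo; _++_)
open import Data.List.Properties using (filter-++; length-++)
open import Data.List.Relation.Unary.All using (_∷_)
open import Data.Nat
open import Data.Nat.Coprimality using (Coprime; coprime-divisor; coprime-Bézout)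
import Data.Nat.Coprimality as Cop
open import Data.Nat.DivMod
open import Data.Nat.Divisibility
open import Data.Nat.GCD using (module Bézout)
open import Data.Nat.Induction using (<-rec)
open import Data.Nat.Primality
  using (Prime; prime?; euclidsLemma; prime⇒irreducible; prime⇒nonZero; prime⇒nonTrivial; ¬prime[1]; prime[2])
open import Data.Nat.Primality.Factorisation using (factorise)
open import Data.Nat.Properties
open import Data.Nat.Tactic.RingSolver using (solve-∀)
open import Data.Product using (∃; ∃₂; _×_; _,_; proj₁; proj₂)
open import Data.Sum using (_⊎_; inj₁; inj₂; [_,_]′)
import Data.Sum as Sum
open import Function using (_∘_; id)
open import Function.Bundles using (_⇔_; Equivalence; mk⇔)
open import Relation.Binary.Bundles using (Setoid)
open import Relation.Binary.PropositionalEquality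
import Relation.Binary.Reasoning.Setoid as SetoidReasoning
open import Relation.Nullary using (¬_; Dec; does; yes; no)
open import Relation.Nullary.Decidable using (dec-true; dec-false; does-⇔; from-yes; _×-dec_; ¬?)

-- Finite sums and counting

∑< : ℕ → (ℕ → ℕ) → ℕ
∑< zero    f = 0
∑< (suc n) f = ∑< n f + f n

module _ {f g : ℕ → ℕ} where

  ∑<-cong : ∀ n → (∀ i → i < n → f i ≡ g i) → ∑< n f ≡ ∑< n g
  ∑<-cong zero    _ = refl
  ∑<-cong (suc n) h = cong₂ _+_ (∑<-cong n (λ i i<n → h i (m<n⇒m<1+n i<n))) (h n ≤-refl)

  ∑<-+ : ∀ n → ∑< n (λ i → f i + g i) ≡ ∑< n f + ∑< n g
  ∑<-+ zero    = refl
  ∑<-+ (suc n) = trans (cong (_+ (f n + g n)) (∑<-+ n)) (interchange (∑< n f) (∑< n g) (f n) (g n))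
    where
    interchange : ∀ a b c d → a + b + (c + d) ≡ a + c + (b + d)
    interchange = solve-∀

∑<-*ʳ : ∀ n f k → ∑< n (λ i → f i * k) ≡ ∑< n f * k
∑<-*ʳ zero    f k = refl
∑<-*ʳ (suc n) f k = trans (cong (_+ f n * k) (∑<-*ʳ n f k)) (sym (*-distribʳ-+ k (∑< n f) (f n)))

∑<-suc : ∀ n f → ∑< (suc n) f ≡ f 0 + ∑< n (f ∘ suc)
∑<-suc zero    f = +-comm 0 (f 0)
∑<-suc (suc n) f = trans (cong (_+ f (suc n)) (∑<-suc n f)) (+-assoc (f 0) _ _)

∑<-+-range : ∀ m n f → ∑< (m + n) f ≡ ∑< m f + ∑< n (λ i → f (m + i))
∑<-+-range m zero    f = trans (cong (λ k → ∑< k f) (+-identityʳ m)) (sym (+-identityʳ _))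
∑<-+-range m (suc n) f = begin
  ∑< (m + suc n) f                                ≡⟨ cong (λ k → ∑< k f) (+-suc m n) ⟩
  ∑< (m + n) f + f (m + n)                        ≡⟨ cong (_+ f (m + n)) (∑<-+-range m n f) ⟩
  ∑< m f + ∑< n (λ i → f (m + i)) + f (m + n)     ≡⟨ +-assoc (∑< m f) _ _ ⟩
  ∑< m f + ∑< (suc n) (λ i → f (m + i))           ∎
  where open ≡-Reasoning

∑<-zero : ∀ n {f} → (∀ i → i < n → f i ≡ 0) → ∑< n f ≡ 0
∑<-zero zero    _ = refl
∑<-zero (suc n) h = cong₂ _+_ (∑<-zero n (λ i i<n → h i (m<n⇒m<1+n i<n))) (h n ≤-refl)

∑<-comm : ∀ a b (f : ℕ → ℕ → ℕ) → ∑< a (λ i → ∑< b (f i)) ≡ ∑< b (λ j → ∑< a (λ i → f i j))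
∑<-comm zero    b f = sym (∑<-zero b (λ _ _ → refl))
∑<-comm (suc a) b f = trans (cong (_+ ∑< b (f a)) (∑<-comm a b f)) (sym (∑<-+ b))

∑<-single : ∀ n k {f : ℕ → ℕ} → k < n → (∀ i → i < n → i ≢ k → f i ≡ 0) → ∑< n f ≡ f k
∑<-single zero    k () h
∑<-single (suc n) k {f} k<1+n h with k ≟ n
... | yes refl = cong (_+ f k) (∑<-zero n (λ i i<n → h i (m<n⇒m<1+n i<n) (<⇒≢ i<n)))
... | no k≢n   = trans (cong₂ _+_ (∑<-single n k (≤∧≢⇒< (≤-pred k<1+n) k≢n) (λ i i<n → h i (m<n⇒m<1+n i<n)))
                                 (h n ≤-refl (k≢n ∘ sym)))
                       (+-identityʳ (f k))

∑<-blocks : ∀ a b f → ∑< (a * b) f ≡ ∑< b (λ t → ∑< a (λ i → f (a * t + i)))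
∑<-blocks a zero    f = cong (λ k → ∑< k f) (*-zeroʳ a)
∑<-blocks a (suc b) f = begin
  ∑< (a * suc b) f                               ≡⟨ cong (λ k → ∑< k f) (trans (*-suc a b) (+-comm a (a * b))) ⟩
  ∑< (a * b + a) f                               ≡⟨ ∑<-+-range (a * b) a f ⟩
  ∑< (a * b) f + ∑< a (λ i → f (a * b + i))      ≡⟨ cong (_+ ∑< a (λ i → f (a * b + i))) (∑<-blocks a b f) ⟩
  ∑< (suc b) (λ t → ∑< a (λ i → f (a * t + i)))  ∎
  where open ≡-Reasoning

indicator : Bool → ℕ
indicator true  = 1
indicator false = 0

count : (ℕ → Bool) → ℕ → ℕ
count p n = ∑< n (indicator ∘ p)

count-≟ : ∀ {n k} → k < n → count (λ i → does (i ≟ k)) n ≡ 1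
count-≟ {n} {k} k<n = trans (∑<-single n k k<n (λ i _ i≢k → cong indicator (dec-false (i ≟ k) i≢k)))
                            (cong indicator (dec-true (k ≟ k) refl))

count-remove : ∀ m {q : ℕ → Bool} k → k < m → q k ≡ true →
               count q m ≡ count (λ i → q i ∧ not (does (i ≟ k))) m + 1
count-remove m {q} k k<m qk = begin
  count q m                                                         ≡⟨ ∑<-cong m (λ i _ → split (i ≟ k)) ⟩
  ∑< m (λ i → indicator (q′ i) + indicator (does (i ≟ k)))          ≡⟨ ∑<-+ m ⟩
  count q′ m + count (λ i → does (i ≟ k)) m                         ≡⟨ cong (count q′ m +_) (count-≟ k<m) ⟩
  count q′ m + 1                                                    ∎
  where
  open ≡-Reasoning
  q′ : ℕ → Bool
  q′ i = q i ∧ not (does (i ≟ k))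
  split : ∀ {i} (i≟k : Dec (i ≡ k)) → indicator (q i) ≡ indicator (q i ∧ not (does i≟k)) + indicator (does i≟k)
  split (yes refl) rewrite qk = refl
  split {i} (no _)     rewrite ∧-identityʳ (q i) = sym (+-identityʳ _)

count-≤ : ∀ n {m} {p q : ℕ → Bool} (h : ℕ → ℕ) →
          (∀ x → x < n → p x ≡ true → h x < m × q (h x) ≡ true) →
          (∀ x y → x < n → y < n → p x ≡ true → p y ≡ true → h x ≡ h y → x ≡ y) →
          count p n ≤ count q m
count-≤ zero    h maps inj = z≤n
count-≤ (suc n) {m} {p} {q} h maps inj with p n in pn
... | false = subst (_≤ count q m) (sym (+-identityʳ _))
                (count-≤ n h (λ x x<n → maps x (m<n⇒m<1+n x<n))
                             (λ x y x<n y<n → inj x y (m<n⇒m<1+n x<n) (m<n⇒m<1+n y<n)))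
... | true  = begin
  count p n + 1     ≤⟨ +-monoˡ-≤ 1 (count-≤ n h maps′ inj′) ⟩
  count q′ m + 1    ≡⟨ count-remove m (h n) (proj₁ (maps n ≤-refl pn)) (proj₂ (maps n ≤-refl pn)) ⟨
  count q m         ∎
  where
  open ≤-Reasoning
  inj′ : ∀ x y → x < n → y < n → p x ≡ true → p y ≡ true → h x ≡ h y → x ≡ y
  inj′ x y x<n y<n = inj x y (m<n⇒m<1+n x<n) (m<n⇒m<1+n y<n)
  q′ : ℕ → Bool
  q′ i = q i ∧ not (does (i ≟ h n))
  maps′ : ∀ x → x < n → p x ≡ true → h x < m × q′ (h x) ≡ true
  maps′ x x<n px = let (hx<m , qhx) = maps x (m<n⇒m<1+n x<n) px in hx<m , keep qhx (h x ≟ h n)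
    where
    keep : ∀ {b} → b ≡ true → (d : Dec (h x ≡ h n)) → b ∧ not (does d) ≡ true
    keep refl (no _)       = refl
    keep _    (yes hx≡hn) = ⊥-elim (<⇒≢ x<n (inj x n (m<n⇒m<1+n x<n) ≤-refl px pn hx≡hn))

count-bijection : ∀ n m {p q : ℕ → Bool} (h k : ℕ → ℕ) →
                  (∀ x → x < n → p x ≡ true → h x < m × q (h x) ≡ true × k (h x) ≡ x) →
                  (∀ y → y < m → q y ≡ true → k y < n × p (k y) ≡ true × h (k y) ≡ y) →
                  count p n ≡ count q m
count-bijection n m h k hk kh = ≤-antisym
  (count-≤ n h (λ x x<n px → let (hx<m , qhx , _) = hk x x<n px in hx<m , qhx)
     (λ x y x<n y<n px py hx≡hy → trans (sym (proj₂ (proj₂ (hk x x<n px))))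
                                        (trans (cong k hx≡hy) (proj₂ (proj₂ (hk y y<n py))))))
  (count-≤ m k (λ y y<m qy → let (ky<n , pky , _) = kh y y<m qy in ky<n , pky)
     (λ x y x<m y<m qx qy kx≡ky → trans (sym (proj₂ (proj₂ (kh x x<m qx))))
                                        (trans (cong h kx≡ky) (proj₂ (proj₂ (kh y y<m qy))))))

count-pair : ∀ n {p : ℕ → Bool} {a b} → a < n → b < n → a ≢ b → p a ≡ true → p b ≡ true →
             (∀ x → x < n → p x ≡ true → x ≡ a ⊎ x ≡ b) → count p n ≡ 2
count-pair n {p} {a} {b} a<n b<n a≢b pa pb only = begin
  count p n                                                             ≡⟨ ∑<-cong n split ⟩
  ∑< n (λ x → indicator (does (x ≟ a)) + indicator (does (x ≟ b)))      ≡⟨ ∑<-+ n ⟩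
  count (λ x → does (x ≟ a)) n + count (λ x → does (x ≟ b)) n           ≡⟨ cong₂ _+_ (count-≟ a<n) (count-≟ b<n) ⟩
  2                                                                     ∎
  where
  open ≡-Reasoning
  split : ∀ x → x < n → indicator (p x) ≡ indicator (does (x ≟ a)) + indicator (does (x ≟ b))
  split x x<n = by-cases (x ≟ a) (x ≟ b)
    where
    by-cases : (x≟a : Dec (x ≡ a)) (x≟b : Dec (x ≡ b)) →
               indicator (p x) ≡ indicator (does x≟a) + indicator (does x≟b)
    by-cases (yes refl) (yes refl) = ⊥-elim (a≢b refl)
    by-cases (yes refl) (no _)     rewrite pa = refl
    by-cases (no _)     (yes refl) rewrite pb = refl
    by-cases (no x≢a)   (no x≢b)   with p x in px
    ... | false = refl
    ... | true  with only x x<n px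
    ...   | inj₁ x≡a = ⊥-elim (x≢a x≡a)
    ...   | inj₂ x≡b = ⊥-elim (x≢b x≡b)

module _ {A : Set} {P : A → Set} (P? : ∀ x → Dec (P x)) where

  length-filter-applyUpTo : ∀ (f : ℕ → A) n →
                            length (filter P? (applyUpTo f n)) ≡ count (λ i → does (P? (f i))) n
  length-filter-applyUpTo f zero    = refl
  length-filter-applyUpTo f (suc n)
    rewrite ∑<-suc n (λ i → indicator (does (P? (f i)))) with does (P? (f 0))
  ... | false = length-filter-applyUpTo (f ∘ suc) n
  ... | true  = cong suc (length-filter-applyUpTo (f ∘ suc) n)

  length-filter-map : ∀ {B : Set} (f : B → A) xs →
                      length (filter P? (map f xs)) ≡ length (filter (P? ∘ f) xs)
  length-filter-map f []       = refl
  length-filter-map f (x ∷ xs) with does (P? (f x))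
  ... | false = length-filter-map f xs
  ... | true  = cong suc (length-filter-map f xs)

  length-filter-concatMap : ∀ (g : ℕ → List A) (f : ℕ → ℕ) n →
    length (filter P? (concatMap g (applyUpTo f n))) ≡ ∑< n (λ i → length (filter P? (g (f i))))
  length-filter-concatMap g f zero    = refl
  length-filter-concatMap g f (suc n) = begin
    length (filter P? (g (f 0) ++ concatMap g (applyUpTo (f ∘ suc) n)))
      ≡⟨ cong length (filter-++ P? (g (f 0)) _) ⟩
    length (filter P? (g (f 0)) ++ filter P? (concatMap g (applyUpTo (f ∘ suc) n)))
      ≡⟨ length-++ (filter P? (g (f 0))) ⟩
    length (filter P? (g (f 0))) + length (filter P? (concatMap g (applyUpTo (f ∘ suc) n)))
      ≡⟨ cong (length (filter P? (g (f 0))) +_) (length-filter-concatMap g (f ∘ suc) n) ⟩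
    length (filter P? (g (f 0))) + ∑< n (λ i → length (filter P? (g (f (suc i)))))
      ≡⟨ sym (∑<-suc n _) ⟩
    ∑< (suc n) (λ i → length (filter P? (g (f i))))  ∎
    where open ≡-Reasoning

does≡true⇒ : ∀ {A : Set} (a? : Dec A) → does a? ≡ true → A
does≡true⇒ (yes a) _ = a

indicator-⊎ : ∀ {A B C : Set} (a? : Dec A) (b? : Dec B) (c? : Dec C) → A ⇔ (B ⊎ C) → ¬ (B × C) →
              indicator (does a?) ≡ indicator (does b?) + indicator (does c?)
indicator-⊎ (yes a) (yes b) (yes c) _   disj = ⊥-elim (disj (b , c))
indicator-⊎ (yes a) (yes b) (no _)  _   _    = refl
indicator-⊎ (yes a) (no _)  (yes c) _   _    = refl
indicator-⊎ (yes a) (no ¬b) (no ¬c) a⇔  _    = ⊥-elim ([ ¬b , ¬c ]′ (Equivalence.to a⇔ a))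
indicator-⊎ (no ¬a) (yes b) _       a⇔  _    = ⊥-elim (¬a (Equivalence.from a⇔ (inj₁ b)))
indicator-⊎ (no ¬a) (no _)  (yes c) a⇔  _    = ⊥-elim (¬a (Equivalence.from a⇔ (inj₂ c)))
indicator-⊎ (no _)  (no _)  (no _)  _   _    = refl

-- Congruences and roots of 4x² + 3

quad : ℕ → ℕ
quad x = 4 * (x * x) + 3

quad-reflect-identity : ∀ a b →
  4 * (b * b) + 3 + 4 * (a + b) * (a + b) ≡ 4 * (a * a) + 3 + 8 * b * (a + b)
quad-reflect-identity = solve-∀

module Mod (n : ℕ) .{{_ : NonZero n}} where

  infix 4 _≋_
  record _≋_ (a b : ℕ) : Set where
    constructor mk
    field %-≡ : a % n ≡ b % n

  ≋-refl : ∀ {a} → a ≋ a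
  ≋-refl = mk refl

  ≋-reflexive : ∀ {a b} → a ≡ b → a ≋ b
  ≋-reflexive refl = ≋-refl

  ≋-sym : ∀ {a b} → a ≋ b → b ≋ a
  ≋-sym (mk e) = mk (sym e)

  ≋-trans : ∀ {a b c} → a ≋ b → b ≋ c → a ≋ c
  ≋-trans (mk e) (mk e′) = mk (trans e e′)

  ≋-setoid : Setoid _ _
  ≋-setoid = record { Carrier = ℕ ; _≈_ = _≋_
                    ; isEquivalence = record { refl = ≋-refl ; sym = ≋-sym ; trans = ≋-trans } }

  module ≋-Reasoning = SetoidReasoning ≋-setoid

  0%n≡0 : 0 % n ≡ 0
  0%n≡0 = n∣m⇒m%n≡0 0 n (n ∣0)

  +-cong : ∀ {a b c d} → a ≋ b → c ≋ d → a + c ≋ b + d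
  +-cong {a} {b} {c} {d} (mk e) (mk e′) = mk (begin
    (a + c) % n              ≡⟨ %-distribˡ-+ a c n ⟩
    (a % n + c % n) % n      ≡⟨ cong₂ (λ x y → (x + y) % n) e e′ ⟩
    (b % n + d % n) % n      ≡⟨ %-distribˡ-+ b d n ⟨
    (b + d) % n              ∎)
    where open ≡-Reasoning

  *-cong : ∀ {a b c d} → a ≋ b → c ≋ d → a * c ≋ b * d
  *-cong {a} {b} {c} {d} (mk e) (mk e′) = mk (begin
    (a * c) % n              ≡⟨ %-distribˡ-* a c n ⟩
    (a % n * (c % n)) % n    ≡⟨ cong₂ (λ x y → (x * y) % n) e e′ ⟩
    (b % n * (d % n)) % n    ≡⟨ %-distribˡ-* b d n ⟨
    (b * d) % n              ∎)
    where open ≡-Reasoning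

  +-multiple : ∀ a k → a + k * n ≋ a
  +-multiple a k = mk ([m+kn]%n≡m%n a k n)

  %-≋ : ∀ a → a % n ≋ a
  %-≋ a = mk (m%n%n≡m%n a n)

  ∣⇒≋0 : ∀ {a} → n ∣ a → a ≋ 0
  ∣⇒≋0 {a} n∣a = mk (trans (n∣m⇒m%n≡0 a n n∣a) (sym 0%n≡0))

  ≋0⇒∣ : ∀ {a} → a ≋ 0 → n ∣ a
  ≋0⇒∣ {a} (mk e) = m%n≡0⇒n∣m a n (trans e 0%n≡0)

  %-≡-< : ∀ {a b} → b < n → a ≋ b → a % n ≡ b
  %-≡-< b<n (mk e) = trans e (m<n⇒m%n≡m b<n)

  quad-cong : ∀ {a b} → a ≋ b → quad a ≋ quad b
  quad-cong a≋b = +-cong (*-cong (≋-refl {4}) (*-cong a≋b a≋b)) (≋-refl {3})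

  root-cong : ∀ {a b} → a ≋ b → n ∣ quad a → n ∣ quad b
  root-cong a≋b n∣qa = ≋0⇒∣ (≋-trans (≋-sym (quad-cong a≋b)) (∣⇒≋0 n∣qa))

  root-reflect : ∀ a b → a + b ≡ n → n ∣ quad a → n ∣ quad b
  root-reflect a b a+b≡n n∣qa = ≋0⇒∣ (begin
    quad b                          ≈⟨ +-multiple (quad b) (4 * n) ⟨
    quad b + 4 * n * n              ≡⟨ cong (λ m → quad b + 4 * m * m) a+b≡n ⟨
    quad b + 4 * (a + b) * (a + b)  ≡⟨ quad-reflect-identity a b ⟩
    quad a + 8 * b * (a + b)        ≡⟨ cong (λ m → quad a + 8 * b * m) a+b≡n ⟩
    quad a + 8 * b * n              ≈⟨ +-multiple (quad a) (8 * b) ⟩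
    quad a                          ≈⟨ ∣⇒≋0 n∣qa ⟩
    0                               ∎)
    where open ≋-Reasoning

isRoot : ℕ → ℕ → Bool
isRoot n x = does (n ∣? quad x)

#roots : ℕ → ℕ
#roots n = count (isRoot n) n

isRoot-cong : ∀ n .{{_ : NonZero n}} {a b} → Mod._≋_ n a b → isRoot n a ≡ isRoot n b
isRoot-cong n {a} {b} a≋b =
  does-⇔ (mk⇔ (Mod.root-cong n a≋b) (Mod.root-cong n (Mod.≋-sym n a≋b))) (n ∣? quad a) (n ∣? quad b)

modular-inverse : ∀ a b .{{_ : NonZero b}} → Coprime a b → ∃ λ a′ → Mod._≋_ b (a * a′) 1
modular-inverse a (suc b′) cp with coprime-Bézout cp
... | Bézout.+- x y eq = x , (begin
  a * x                  ≡⟨ *-comm a x ⟩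
  x * a                  ≡⟨ eq ⟨
  1 + y * suc b′         ≈⟨ +-multiple 1 y ⟩
  1                      ∎)
  where open Mod (suc b′); open ≋-Reasoning
-- Here a x ≡ −1 and −1 ≡ b′ modulo b = 1 + b′, so x b′ is the inverse.
... | Bézout.-+ x y eq = x * b′ , (begin
  a * (x * b′)                  ≈⟨ +-multiple _ 1 ⟨
  a * (x * b′) + 1 * suc b′     ≡⟨ identity₁ a x b′ ⟩
  (1 + x * a) * b′ + 1          ≡⟨ cong (λ m → m * b′ + 1) eq ⟩
  y * suc b′ * b′ + 1           ≡⟨ identity₂ y b′ ⟩
  1 + y * b′ * suc b′           ≈⟨ +-multiple 1 (y * b′) ⟩
  1                             ∎)
  where
  open Mod (suc b′); open ≋-Reasoning
  identity₁ : ∀ a x b′ → a * (x * b′) + 1 * suc b′ ≡ (1 + x * a) * b′ + 1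
  identity₁ = solve-∀
  identity₂ : ∀ y b′ → y * suc b′ * b′ + 1 ≡ 1 + y * b′ * suc b′
  identity₂ = solve-∀

count-roots-affine : ∀ {a} b .{{_ : NonZero b}} → Coprime a b → ∀ i →
                     count (λ t → isRoot b (a * t + i)) b ≡ #roots b
-- t ↦ (a t + i) mod b is inverted by y ↦ a′ (y − i) mod b, with −i ≡ b′ i as b = 1 + b′.
count-roots-affine {a} (suc b′) cp i with modular-inverse a (suc b′) cp
... | a′ , aa′≋1 = count-bijection b b h k h-k k-h
  where
  b = suc b′
  open Mod b
  open ≋-Reasoning
  h k : ℕ → ℕ
  h t = (a * t + i) % b
  k y = (a′ * (y + b′ * i)) % b
  k∘h : ∀ t → a′ * ((a * t + i) % b + b′ * i) ≋ t
  k∘h t = begin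
    a′ * ((a * t + i) % b + b′ * i)      ≈⟨ *-cong (≋-refl {a′}) (+-cong (%-≋ (a * t + i)) (≋-refl {b′ * i})) ⟩
    a′ * (a * t + i + b′ * i)            ≡⟨ identity₁ a′ a t i b′ ⟩
    a * a′ * t + a′ * i * b              ≈⟨ +-multiple (a * a′ * t) (a′ * i) ⟩
    a * a′ * t                           ≈⟨ *-cong aa′≋1 (≋-refl {t}) ⟩
    1 * t                                ≡⟨ *-identityˡ t ⟩
    t                                    ∎
    where
    identity₁ : ∀ a′ a t i b′ → a′ * (a * t + i + b′ * i) ≡ a * a′ * t + a′ * i * suc b′
    identity₁ = solve-∀
  h∘k : ∀ y → a * k y + i ≋ y
  h∘k y = begin
    a * k y + i                          ≈⟨ +-cong (*-cong (≋-refl {a}) (%-≋ (a′ * (y + b′ * i)))) (≋-refl {i}) ⟩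
    a * (a′ * (y + b′ * i)) + i          ≡⟨ identity₁ a a′ y b′ i ⟩
    a * a′ * (y + b′ * i) + i            ≈⟨ +-cong (*-cong aa′≋1 (≋-refl {y + b′ * i})) (≋-refl {i}) ⟩
    1 * (y + b′ * i) + i                 ≡⟨ identity₂ y b′ i ⟩
    y + i * b                            ≈⟨ +-multiple y i ⟩
    y                                    ∎
    where
    identity₁ : ∀ a a′ y b′ i → a * (a′ * (y + b′ * i)) + i ≡ a * a′ * (y + b′ * i) + i
    identity₁ = solve-∀
    identity₂ : ∀ y b′ i → 1 * (y + b′ * i) + i ≡ y + i * suc b′
    identity₂ = solve-∀
  h-k : ∀ t → t < b → isRoot b (a * t + i) ≡ true → h t < b × isRoot b (h t) ≡ true × k (h t) ≡ t
  h-k t t<b root = m%n<n (a * t + i) b , trans (isRoot-cong b (%-≋ (a * t + i))) root , %-≡-< t<b (k∘h t)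
  k-h : ∀ y → y < b → isRoot b y ≡ true → k y < b × isRoot b (a * k y + i) ≡ true × h (k y) ≡ y
  k-h y y<b root = m%n<n (a′ * (y + b′ * i)) b , trans (isRoot-cong b (h∘k y)) root , %-≡-< y<b (h∘k y)

coprime-*∣ : ∀ {a b m} → Coprime a b → a ∣ m → b ∣ m → a * b ∣ m
coprime-*∣ {a} {b} cp (divides q refl) b∣qa with coprime-divisor (Cop.sym cp) (subst (b ∣_) (*-comm q a) b∣qa)
... | divides r refl = divides r (reassoc r b a)
  where
  reassoc : ∀ r b a → r * b * a ≡ r * (a * b)
  reassoc = solve-∀

#roots-* : ∀ a b .{{_ : NonZero a}} .{{_ : NonZero b}} → Coprime a b →
           #roots (a * b) ≡ #roots a * #roots b
#roots-* a b cp = begin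
  #roots (a * b)                                                      ≡⟨ ∑<-blocks a b _ ⟩
  ∑< b (λ t → ∑< a (λ i → indicator (isRoot (a * b) (a * t + i))))   ≡⟨ ∑<-comm b a _ ⟩
  ∑< a (λ i → count (λ t → isRoot (a * b) (a * t + i)) b)            ≡⟨ ∑<-cong a (λ i _ → column i) ⟩
  ∑< a (λ i → indicator (isRoot a i) * #roots b)                      ≡⟨ ∑<-*ʳ a _ (#roots b) ⟩
  #roots a * #roots b                                                 ∎
  where
  open ≡-Reasoning
  shift : ∀ t i → Mod._≋_ a (a * t + i) i
  shift t i = Mod.≋-trans a (Mod.≋-reflexive a (+-comm (a * t) i)) (Mod.≋-trans a
                (Mod.≋-reflexive a (cong (i +_) (*-comm a t))) (Mod.+-multiple a i t))
  column : ∀ i → count (λ t → isRoot (a * b) (a * t + i)) b ≡ indicator (isRoot a i) * #roots b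
  column i with a ∣? quad i
  ... | no a∤qi = ∑<-zero b (λ t _ → cong indicator (dec-false (a * b ∣? quad (a * t + i))
                    (λ ab∣q → a∤qi (Mod.root-cong a (shift t i) (∣-trans (m∣m*n b) ab∣q)))))
  ... | yes a∣qi = begin
      count (λ t → isRoot (a * b) (a * t + i)) b  ≡⟨ ∑<-cong b (λ t _ → cong indicator (roots-agree t)) ⟩
      count (λ t → isRoot b (a * t + i)) b        ≡⟨ count-roots-affine b cp i ⟩
      #roots b                                    ≡⟨ +-identityʳ (#roots b) ⟨
      1 * #roots b                                ∎
    where
    roots-agree : ∀ t → isRoot (a * b) (a * t + i) ≡ isRoot b (a * t + i)
    roots-agree t = does-⇔ (mk⇔ (∣-trans (n∣m*n a))
                                (coprime-*∣ cp (Mod.root-cong a (Mod.≋-sym a (shift t i)) a∣qi)))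
                           (a * b ∣? quad (a * t + i)) (b ∣? quad (a * t + i))

-- Roots modulo prime powers

prime[3] : Prime 3
prime[3] = from-yes (prime? 3)

prime∣prime⇒≡ : ∀ {p r} → Prime p → Prime r → r ∣ p → r ≡ p
prime∣prime⇒≡ pp pr r∣p with prime⇒irreducible pp r∣p
... | inj₁ refl = ⊥-elim (¬prime[1] pr)
... | inj₂ r≡p  = r≡p

prime∣^⇒≡ : ∀ {p r} k → Prime p → Prime r → r ∣ p ^ k → r ≡ p
prime∣^⇒≡ zero    pp pr r∣1 = ⊥-elim (¬prime[1] (subst Prime (∣1⇒≡1 r∣1) pr))
prime∣^⇒≡ {p} (suc k) pp pr r∣p^k with euclidsLemma p (p ^ k) pr r∣p^k
... | inj₁ r∣p   = prime∣prime⇒≡ pp pr r∣p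
... | inj₂ r∣p^k = prime∣^⇒≡ k pp pr r∣p^k

prime-coprime : ∀ {p m} → Prime p → ¬ p ∣ m → Coprime p m
prime-coprime pp p∤m (d∣p , d∣m) with prime⇒irreducible pp d∣p
... | inj₁ d≡1 = d≡1
... | inj₂ refl = ⊥-elim (p∤m d∣m)

^-coprime : ∀ {a m} k → Coprime a m → Coprime (a ^ k) m
^-coprime zero    cp (d∣1 , _)       = ∣1⇒≡1 d∣1
^-coprime {a} (suc k) cp {d} (d∣a^k , d∣m) =
  ^-coprime k cp (coprime-divisor d⊥a d∣a^k , d∣m)
  where
  d⊥a : Coprime d a
  d⊥a (e∣d , e∣a) = cp (e∣a , ∣-trans e∣d d∣m)

quad-odd : ∀ x → ¬ 2 ∣ quad x
quad-odd x 2∣qx with ∣m+n∣m⇒∣n 2∣qx (∣m⇒∣m*n (x * x) (divides 2 refl))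
... | divides (suc zero) ()
... | divides (suc (suc _)) ()

∣quad⇒≢2 : ∀ {p} x → p ∣ quad x → p ≢ 2
∣quad⇒≢2 x p∣qx refl = quad-odd x p∣qx

prime∣quad∧∣⇒≡3 : ∀ {p x} → Prime p → p ∣ x → p ∣ quad x → p ≡ 3
prime∣quad∧∣⇒≡3 {x = x} pp p∣x p∣qx =
  prime∣prime⇒≡ prime[3] pp (∣m+n∣m⇒∣n p∣qx (∣n⇒∣m*n 4 (∣m⇒∣m*n x p∣x)))

9∤quad : ∀ x → ¬ 9 ∣ quad x
9∤quad x 9∣qx = no-root (x % 9) (m%n<n x 9)
                 (n∣m⇒m%n≡0 (quad (x % 9)) 9 (Mod.root-cong 9 (Mod.≋-sym 9 (Mod.%-≋ 9 x)) 9∣qx))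
  where
  no-root : ∀ r → r < 9 → ¬ quad r % 9 ≡ 0
  no-root 0 _ ()
  no-root 1 _ ()
  no-root 2 _ ()
  no-root 3 _ ()
  no-root 4 _ ()
  no-root 5 _ ()
  no-root 6 _ ()
  no-root 7 _ ()
  no-root 8 _ ()
  no-root (suc (suc (suc (suc (suc (suc (suc (suc (suc r))))))))) r<9 = ⊥-elim (<⇒≱ r<9 (m≤m+n 9 r))

quad-+ : ∀ y d → 4 * ((y + d) * (y + d)) + 3 ≡ 4 * (y * y) + 3 + 4 * (d * (y + y + d))
quad-+ = solve-∀

∣∧<⇒≡0 : ∀ {m n} → m ∣ n → n < m → n ≡ 0
∣∧<⇒≡0 {n = zero}  _   _   = refl
∣∧<⇒≡0 {n = suc n} m∣n n<m = ⊥-elim (<⇒≱ n<m (∣⇒≤ m∣n))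

∣∧<2*⇒≡ : ∀ {m n} → m ∣ n → 0 < n → n < m + m → n ≡ m
∣∧<2*⇒≡ (divides zero refl) () _
∣∧<2*⇒≡ {m} (divides 1 refl) _ _ = +-identityʳ m
∣∧<2*⇒≡ {m} (divides (suc (suc j)) refl) _ n<2m =
  ⊥-elim (<⇒≱ n<2m (+-monoʳ-≤ m (m≤m+n m (j * m))))

module PrimePowerRoots {p} (pp : Prime p) (p≢3 : p ≢ 3) (k : ℕ) where

  q : ℕ
  q = p ^ suc k

  instance
    q≢0 : NonZero q
    q≢0 = m^n≢0 p (suc k) {{prime⇒nonZero pp}}

  p∣q : p ∣ q
  p∣q = m∣m*n (p ^ k)

  q∣*∧p∤⇒q∣ : ∀ {a b} → q ∣ a * b → ¬ p ∣ a → q ∣ b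
  q∣*∧p∤⇒q∣ q∣ab p∤a = coprime-divisor (^-coprime (suc k) (prime-coprime pp p∤a)) q∣ab

  p∤2 : ∀ x → q ∣ quad x → ¬ p ∣ 2
  p∤2 x q∣qx p∣2 = ∣quad⇒≢2 x (∣-trans p∣q q∣qx) (prime∣prime⇒≡ prime[2] pp p∣2)

  root≢0 : ∀ x → q ∣ quad x → x ≢ 0
  root≢0 _ q∣q0 refl = p≢3 (prime∣prime⇒≡ prime[3] pp (∣-trans p∣q q∣q0))

  -- Writing x = y + d, q divides quad x − quad y = 4 d (x + y), and p divides at most one of d, x + y.
  roots-pair : ∀ {x y} → x < q → q ∣ quad x → q ∣ quad y → y ≤ x → x ≡ y ⊎ x + y ≡ q
  roots-pair {x} {y} x<q q∣qx q∣qy y≤x with m≤n⇒∃[o]m+o≡n y≤x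
  ... | d , refl = by-cases (p ∣? d)
    where
    p∤4 : ¬ p ∣ 4
    p∤4 p∣4 = p∤2 y q∣qy ([ id , id ]′ (euclidsLemma 2 2 pp p∣4))
    q∣d[2y+d] : q ∣ d * (y + y + d)
    q∣d[2y+d] = q∣*∧p∤⇒q∣ (∣m+n∣m⇒∣n (subst (q ∣_) (quad-+ y d) q∣qx) q∣qy) p∤4
    by-cases : Dec (p ∣ d) → y + d ≡ y ⊎ y + d + y ≡ q
    by-cases (no p∤d) =
      inj₂ (trans (reorder y d) (∣∧<2*⇒≡ (q∣*∧p∤⇒q∣ q∣d[2y+d] p∤d) 0<2y+d 2y+d<2q))
      where
      reorder : ∀ y d → y + d + y ≡ y + y + d
      reorder = solve-∀
      0<2y+d : 0 < y + y + d
      0<2y+d = <-≤-trans (n≢0⇒n>0 (root≢0 y q∣qy)) (≤-trans (m≤m+n y y) (m≤m+n (y + y) d))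
      2y+d<2q : y + y + d < q + q
      2y+d<2q = subst (_< q + q) (reorder y d) (+-mono-< x<q (≤-<-trans (m≤m+n y d) x<q))
    by-cases (yes p∣d) =
      inj₁ (trans (cong (y +_) (∣∧<⇒≡0 q∣d (≤-<-trans (m≤n+m d y) x<q))) (+-identityʳ y))
      where
      double : ∀ y → y + y ≡ 2 * y
      double = solve-∀
      p∤2y+d : ¬ p ∣ y + y + d
      p∤2y+d p∣2y+d
        with euclidsLemma 2 y pp (subst (p ∣_) (double y) (∣m+n∣m⇒∣n (subst (p ∣_) (+-comm (y + y) d) p∣2y+d) p∣d))
      ... | inj₁ p∣2 = p∤2 y q∣qy p∣2
      ... | inj₂ p∣y = p≢3 (prime∣quad∧∣⇒≡3 pp p∣y (∣-trans p∣q q∣qy))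
      q∣d : q ∣ d
      q∣d = q∣*∧p∤⇒q∣ (subst (q ∣_) (*-comm d _) q∣d[2y+d]) p∤2y+d

  #roots≡2 : ∀ x → q ∣ quad x → #roots q ≡ 2
  #roots≡2 x q∣qx =
    count-pair q x₀<q w<q x₀≢w (dec-true (q ∣? quad x₀) q∣qx₀) (dec-true (q ∣? quad w) q∣qw) only
    where
    x₀ = x % q
    w  = q ∸ x₀
    x₀<q : x₀ < q
    x₀<q = m%n<n x q
    q∣qx₀ : q ∣ quad x₀
    q∣qx₀ = Mod.root-cong q (Mod.≋-sym q (Mod.%-≋ q x)) q∣qx
    x₀+w≡q : x₀ + w ≡ q
    x₀+w≡q = m+[n∸m]≡n (<⇒≤ x₀<q)
    w<q : w < q
    w<q = ∸-monoʳ-< (n≢0⇒n>0 (root≢0 x₀ q∣qx₀)) (<⇒≤ x₀<q)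
    q∣qw : q ∣ quad w
    q∣qw = Mod.root-reflect q x₀ w x₀+w≡q q∣qx₀
    x₀≢w : x₀ ≢ w
    x₀≢w x₀≡w =
      quad-odd x₀ (∣-trans (divides x₀ (trans (sym x₀+w≡q) (trans (cong (x₀ +_) (sym x₀≡w)) (double x₀)))) q∣qx₀)
      where
      double : ∀ x → x + x ≡ x * 2
      double = solve-∀
    only : ∀ y → y < q → isRoot q y ≡ true → y ≡ x₀ ⊎ y ≡ w
    only y y<q root with ≤-total x₀ y
    ... | inj₁ x₀≤y = Sum.map id (λ y+x₀≡q → trans (sym (m+n∸n≡m y x₀)) (cong (_∸ x₀) y+x₀≡q))
                        (roots-pair y<q (does≡true⇒ (q ∣? quad y) root) q∣qx₀ x₀≤y)
    ... | inj₂ y≤x₀ = Sum.map sym (λ x₀+y≡q → trans (sym (m+n∸m≡n x₀ y)) (cong (_∸ x₀) x₀+y≡q))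
                        (roots-pair x₀<q q∣qx₀ (does≡true⇒ (q ∣? quad y) root) y≤x₀)

-- The number of roots and the prime factorisation

prime>1 : ∀ {p} → Prime p → 1 < p
prime>1 {p} pp = nonTrivial⇒n>1 p {{prime⇒nonTrivial pp}}

prime-factor : ∀ n .{{_ : NonZero n}} → 1 < n → ∃ λ p → Prime p × p ∣ n
prime-factor n 1<n with factorise n
... | record { factors = p ∷ ps ; isFactorisation = n≡p*ps ; factorsPrime = pp ∷ _ } =
  p , pp , subst (p ∣_) (sym n≡p*ps) (m∣m*n _)
... | record { factors = [] ; isFactorisation = refl } = ⊥-elim (<-irrefl refl 1<n)

split-prime-power : ∀ {p} → Prime p → ∀ n .{{_ : NonZero n}} → ∃₂ λ k m → n ≡ p ^ k * m × ¬ p ∣ m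
split-prime-power {p} pp = <-rec (λ n → .{{NonZero n}} → ∃₂ λ k m → n ≡ p ^ k * m × ¬ p ∣ m) step
  where
  step : ∀ n → (∀ {n′} → n′ < n → .{{NonZero n′}} → ∃₂ λ k m → n′ ≡ p ^ k * m × ¬ p ∣ m) →
         .{{NonZero n}} → ∃₂ λ k m → n ≡ p ^ k * m × ¬ p ∣ m
  step n rec with p ∣? n
  ... | no p∤n = 0 , n , sym (+-identityʳ n) , p∤n
  ... | yes (divides j refl) with rec {j} j<n {{j≢0}}
    where
    j≢0 : NonZero j
    j≢0 = m*n≢0⇒m≢0 j
    j<n : j < j * p
    j<n = m<m*n j p {{j≢0}} (prime>1 pp)
  ...   | k , m , refl , p∤m = suc k , m , reassoc (p ^ k) m p , p∤m
    where
    reassoc : ∀ a m p → a * m * p ≡ p * a * m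
    reassoc = solve-∀

isPrimeFactorNot3? : ∀ n p → Dec (Prime p × p ∣ n × p ≢ 3)
isPrimeFactorNot3? n p = prime? p ×-dec ((p ∣? n) ×-dec ¬? (p ≟ 3))

isPrimeFactorNot3 : ℕ → ℕ → Bool
isPrimeFactorNot3 n p = does (isPrimeFactorNot3? n p)

count-isPrimeFactorNot3 : ∀ n .{{_ : NonZero n}} d →
                          count (isPrimeFactorNot3 n) (suc n + d) ≡ numPrimeFactorsNot3 n
count-isPrimeFactorNot3 n d = begin
  count (isPrimeFactorNot3 n) (suc n + d)
    ≡⟨ ∑<-+-range (suc n) d _ ⟩
  count (isPrimeFactorNot3 n) (suc n) + ∑< d (λ i → indicator (isPrimeFactorNot3 n (suc n + i)))
    ≡⟨ cong (count (isPrimeFactorNot3 n) (suc n) +_) (∑<-zero d beyond-n) ⟩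
  count (isPrimeFactorNot3 n) (suc n) + 0
    ≡⟨ +-identityʳ _ ⟩
  count (isPrimeFactorNot3 n) (suc n)
    ≡⟨ length-filter-applyUpTo (isPrimeFactorNot3? n) id (suc n) ⟨
  numPrimeFactorsNot3 n
    ∎
  where
  open ≡-Reasoning
  beyond-n : ∀ i → i < d → indicator (isPrimeFactorNot3 n (suc n + i)) ≡ 0
  beyond-n i _ = cong indicator (dec-false (isPrimeFactorNot3? n (suc n + i))
                                           (λ (_ , r∣n , _) → <⇒≱ (s≤s (m≤m+n n i)) (∣⇒≤ r∣n)))

numPrimeFactorsNot3-^* : ∀ {p} k m .{{_ : NonZero m}} → Prime p → ¬ p ∣ m →
  numPrimeFactorsNot3 (p ^ suc k * m) ≡ numPrimeFactorsNot3 m + indicator (does (¬? (p ≟ 3)))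
numPrimeFactorsNot3-^* {p} k m pp p∤m = begin
  numPrimeFactorsNot3 n
    ≡⟨ count-isPrimeFactorNot3 n 0 ⟨
  count (isPrimeFactorNot3 n) (suc n + 0)
    ≡⟨ cong (count (isPrimeFactorNot3 n)) (+-identityʳ (suc n)) ⟩
  count (isPrimeFactorNot3 n) (suc n)
    ≡⟨ ∑<-cong (suc n) (λ r _ → split r) ⟩
  ∑< (suc n) (λ r → indicator (isPrimeFactorNot3 m r) + indicator (does (is-p r)))
    ≡⟨ ∑<-+ (suc n) ⟩
  count (isPrimeFactorNot3 m) (suc n) + count (does ∘ is-p) (suc n)
    ≡⟨ cong₂ _+_ first second ⟩
  numPrimeFactorsNot3 m + indicator (does (¬? (p ≟ 3)))
    ∎
  where
  open ≡-Reasoning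
  q = p ^ suc k
  n = q * m
  instance
    _ = prime⇒nonZero pp
    q≢0 : NonZero q
    q≢0 = m^n≢0 p (suc k)
    n≢0 : NonZero n
    n≢0 = m*n≢0 q m
  is-p : ∀ r → Dec (r ≡ p × r ≢ 3)
  is-p r = (r ≟ p) ×-dec ¬? (r ≟ 3)
  split : ∀ r → indicator (isPrimeFactorNot3 n r) ≡
                indicator (isPrimeFactorNot3 m r) + indicator (does (is-p r))
  split r = indicator-⊎ (isPrimeFactorNot3? n r) (isPrimeFactorNot3? m r) (is-p r) (mk⇔ to from) disjoint
    where
    to : Prime r × r ∣ n × r ≢ 3 → (Prime r × r ∣ m × r ≢ 3) ⊎ (r ≡ p × r ≢ 3)
    to (pr , r∣n , r≢3) with euclidsLemma q m pr r∣n
    ... | inj₁ r∣q = inj₂ (prime∣^⇒≡ (suc k) pp pr r∣q , r≢3)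
    ... | inj₂ r∣m = inj₁ (pr , r∣m , r≢3)
    from : (Prime r × r ∣ m × r ≢ 3) ⊎ (r ≡ p × r ≢ 3) → Prime r × r ∣ n × r ≢ 3
    from (inj₁ (pr , r∣m , r≢3))  = pr , ∣-trans r∣m (n∣m*n q) , r≢3
    from (inj₂ (refl , r≢3))      = pp , ∣-trans (m∣m*n (p ^ k)) (m∣m*n m) , r≢3
    disjoint : ¬ ((Prime r × r ∣ m × r ≢ 3) × (r ≡ p × r ≢ 3))
    disjoint ((_ , r∣m , _) , refl , _) = p∤m r∣m
  first : count (isPrimeFactorNot3 m) (suc n) ≡ numPrimeFactorsNot3 m
  first = trans (cong (λ b → count (isPrimeFactorNot3 m) (suc b)) (sym (m+[n∸m]≡n (m≤n*m m q))))
                (count-isPrimeFactorNot3 m (n ∸ m))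
  second : count (does ∘ is-p) (suc n) ≡ indicator (does (¬? (p ≟ 3)))
  second = trans (∑<-single (suc n) p (s≤s (∣⇒≤ (∣-trans (m∣m*n (p ^ k)) (m∣m*n m))))
                            (λ r _ r≢p → cong indicator (dec-false (is-p r) (r≢p ∘ proj₁))))
                 (cong indicator (does-⇔ (mk⇔ proj₂ (refl ,_)) (is-p p) (¬? (p ≟ 3))))

3^∣quad⇒≡0 : ∀ k x → 3 ^ suc k ∣ quad x → k ≡ 0
3^∣quad⇒≡0 zero    x _        = refl
3^∣quad⇒≡0 (suc k) x 3^k∣qx = ⊥-elim (9∤quad x (∣-trans (divides (3 ^ k) (reorder (3 ^ k))) 3^k∣qx))
  where
  reorder : ∀ a → 3 * (3 * a) ≡ a * 9
  reorder = solve-∀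

#roots-prime-power : ∀ {p} k x → Prime p → p ^ suc k ∣ quad x →
                     #roots (p ^ suc k) ≡ 2 ^ indicator (does (¬? (p ≟ 3)))
#roots-prime-power {p} k x pp q∣qx with p ≟ 3
... | yes refl = cong (λ j → #roots (3 ^ suc j)) (3^∣quad⇒≡0 k x q∣qx)
... | no p≢3   = trans (PrimePowerRoots.#roots≡2 pp p≢3 k x q∣qx)
                       (cong (λ b → 2 ^ indicator (not b)) (sym (dec-false (p ≟ 3) p≢3)))

#roots-^* : ∀ {p} k m x .{{_ : NonZero m}} → Prime p → ¬ p ∣ m → p ^ suc k * m ∣ quad x →
            #roots m ≡ 2 ^ numPrimeFactorsNot3 m →
            #roots (p ^ suc k * m) ≡ 2 ^ numPrimeFactorsNot3 (p ^ suc k * m)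
#roots-^* {p} k m x pp p∤m n∣qx IH = begin
  #roots (q * m)                          ≡⟨ #roots-* q m (^-coprime (suc k) (prime-coprime pp p∤m)) ⟩
  #roots q * #roots m                     ≡⟨ cong₂ _*_ (#roots-prime-power k x pp (∣-trans (m∣m*n m) n∣qx)) IH ⟩
  2 ^ [p≢3] * 2 ^ numPrimeFactorsNot3 m   ≡⟨ ^-distribˡ-+-* 2 [p≢3] _ ⟨
  2 ^ ([p≢3] + numPrimeFactorsNot3 m)     ≡⟨ cong (2 ^_) (+-comm [p≢3] _) ⟩
  2 ^ (numPrimeFactorsNot3 m + [p≢3])     ≡⟨ cong (2 ^_) (numPrimeFactorsNot3-^* k m pp p∤m) ⟨
  2 ^ numPrimeFactorsNot3 (q * m)         ∎
  where
  open ≡-Reasoning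
  q = p ^ suc k
  [p≢3] = indicator (does (¬? (p ≟ 3)))
  instance
    _ = prime⇒nonZero pp
    q≢0 : NonZero q
    q≢0 = m^n≢0 p (suc k)

#roots≡2^numPrimeFactorsNot3 : ∀ n .{{_ : NonZero n}} → (∃ λ x → n ∣ quad x) →
                               #roots n ≡ 2 ^ numPrimeFactorsNot3 n
#roots≡2^numPrimeFactorsNot3 = <-rec P step
  where
  P : ℕ → Set
  P n = .{{NonZero n}} → (∃ λ x → n ∣ quad x) → #roots n ≡ 2 ^ numPrimeFactorsNot3 n
  step : ∀ n → (∀ {m} → m < n → P m) → P n
  step 1                _   _           = refl
  step n@(suc (suc _)) rec (x , n∣qx) with prime-factor n (s≤s (s≤s z≤n))
  ... | p , pp , p∣n with split-prime-power pp n
  ...   | zero  , m , n≡m  , p∤m = ⊥-elim (p∤m (subst (p ∣_) (trans n≡m (*-identityˡ m)) p∣n))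
  ...   | suc k , m , n≡qm , p∤m = begin
    #roots n                          ≡⟨ cong #roots n≡qm ⟩
    #roots (q * m)                    ≡⟨ #roots-^* k m x pp p∤m qm∣qx (rec m<n (x , ∣-trans (n∣m*n q) qm∣qx)) ⟩
    2 ^ numPrimeFactorsNot3 (q * m)   ≡⟨ cong (λ n → 2 ^ numPrimeFactorsNot3 n) n≡qm ⟨
    2 ^ numPrimeFactorsNot3 n         ∎
    where
    open ≡-Reasoning
    q = p ^ suc k
    instance
      _ = prime⇒nonZero pp
      m≢0 : NonZero m
      m≢0 = ≢-nonZero (λ { refl → p∤m (p ∣0) })
    qm∣qx : q * m ∣ quad x
    qm∣qx = subst (_∣ quad x) n≡qm n∣qx
    m<n : m < n
    m<n = subst (m <_) (trans (*-comm m q) (sym n≡qm))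
                (m<m*n m q (<-≤-trans (prime>1 pp) (m≤m*n p (p ^ k) {{m^n≢0 p k}})))

-- Fair games and roots

e₁ e₂ : ℕ → ℕ → ℕ → ℕ
e₁ x y z = x + y + z
e₂ x y z = x * y + x * z + y * z

fairGame-cong : ∀ {x y z x′ y′ z′} → e₁ x y z ≡ e₁ x′ y′ z′ → e₂ x y z ≡ e₂ x′ y′ z′ →
                FairGame x y z → FairGame x′ y′ z′
fairGame-cong e₁≡ e₂≡ fair =
  trans (cong (λ s → s * s) (sym e₁≡)) (trans fair (cong₂ (λ s t → s + 4 * t) e₁≡ e₂≡))

fairGame-rotate : ∀ {x y z} → FairGame x y z → FairGame y z x
fairGame-rotate {x} {y} {z} = fairGame-cong {x} {y} {z} {y} {z} {x} (rotate-e₁ x y z) (rotate-e₂ x y z)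
  where
  rotate-e₁ : ∀ x y z → x + y + z ≡ y + z + x
  rotate-e₁ = solve-∀
  rotate-e₂ : ∀ x y z → x * y + x * z + y * z ≡ y * z + y * x + z * x
  rotate-e₂ = solve-∀

fairGame-swap : ∀ {x y z} → FairGame x y z → FairGame y x z
fairGame-swap {x} {y} {z} = fairGame-cong {x} {y} {z} {y} {x} {z} (swap-e₁ x y z) (swap-e₂ x y z)
  where
  swap-e₁ : ∀ x y z → x + y + z ≡ y + x + z
  swap-e₁ = solve-∀
  swap-e₂ : ∀ x y z → x * y + x * z + y * z ≡ y * x + y * z + x * z
  swap-e₂ = solve-∀

fairGame-moveLast : ∀ {c x₁ x₂ x₃} → FairGame x₁ x₂ x₃ → c ≡ x₁ ⊎ c ≡ x₂ ⊎ c ≡ x₃ → ∃₂ λ x y → FairGame x y c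
fairGame-moveLast {x₁ = x₁} {x₂} {x₃} fair (inj₁ refl)        = x₂ , x₃ , fairGame-rotate {x₁} fair
fairGame-moveLast {x₁ = x₁} {x₂} {x₃} fair (inj₂ (inj₁ refl)) = x₃ , x₁ , fairGame-rotate {x₂} (fairGame-rotate {x₁} fair)
fairGame-moveLast {x₁ = x₁} {x₂}       fair (inj₂ (inj₂ refl)) = x₁ , x₂ , fair

fairGame-identity : ∀ a u c →
  (a + (a + u) + c) * (a + (a + u) + c) + ((a + a + u) * (2 * c + 1) + c)
  ≡ (a + (a + u) + c) + 4 * (a * (a + u) + a * c + (a + u) * c) + (u * u + c * c)
fairGame-identity = solve-∀

fairGame⇒squares : ∀ a u c → FairGame a (a + u) c → (a + a + u) * (2 * c + 1) + c ≡ u * u + c * c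
fairGame⇒squares a u c fair = +-cancelˡ-≡ (s + 4 * e₂ a (a + u) c) _ _
  (trans (cong (_+ ((a + a + u) * (2 * c + 1) + c)) (sym fair)) (fairGame-identity a u c))
  where s = a + (a + u) + c

squares⇒fairGame : ∀ a u c → (a + a + u) * (2 * c + 1) + c ≡ u * u + c * c → FairGame a (a + u) c
squares⇒fairGame a u c eq = +-cancelʳ-≡ ((a + a + u) * (2 * c + 1) + c) _ _
  (trans (fairGame-identity a u c) (cong (s + 4 * e₂ a (a + u) c +_) (sym eq)))
  where s = a + (a + u) + c

2∣n*[1+n] : ∀ n → 2 ∣ n * suc n
2∣n*[1+n] zero    = 2 ∣0
2∣n*[1+n] (suc n) = subst (2 ∣_) (step n) (∣m∣n⇒∣m+n (2∣n*[1+n] n) (∣m⇒∣m*n (suc n) (∣-refl {2})))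
  where
  step : ∀ n → n * suc n + 2 * suc n ≡ suc n * suc (suc n)
  step = solve-∀

-- 4c² − 4c − 3 = (2c − 3)(2c + 1), written for c = 2 + e so that no subtraction occurs.
4c²-identity : ∀ u e →
  4 * (u * u + (2 + e) * (2 + e)) ≡ 4 * (u * u) + 3 + (2 * e + 1) * (2 * (2 + e) + 1) + 4 * (2 + e)
4c²-identity = solve-∀

squares-gap : ∀ {u c} v w t → suc v + w ≡ u → u + t ≡ c →
              u * u + c * c ≡ v * (2 * c + 1) + c + suc (t * t + t + w * (2 * c + 1))
squares-gap v w t refl refl = identity v w t
  where
  identity : ∀ v w t → (1 + v + w) * (1 + v + w) + (1 + v + w + t) * (1 + v + w + t)
    ≡ v * (2 * (1 + v + w + t) + 1) + (1 + v + w + t) + suc (t * t + t + w * (2 * (1 + v + w + t) + 1))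
  identity = solve-∀

module GamesWithMax (e : ℕ) where

  c N : ℕ
  c = 2 + e
  N = 2 * c + 1

  open Mod N

  c<N : c < N
  c<N = subst (c <_) (+-comm 1 (2 * c)) (s≤s (m≤n*m c 2))

  fair⇒root : ∀ a u → FairGame a (a + u) c → N ∣ quad u
  fair⇒root a u fair =
    ∣m+n∣m⇒∣n (divides (4 * (a + a + u)) (trans (+-comm _ (quad u)) (sym 4·squares))) (n∣m*n (2 * e + 1))
    where
    4·squares : 4 * (a + a + u) * N ≡ quad u + (2 * e + 1) * N
    4·squares = +-cancelʳ-≡ (4 * c) _ _ (begin
      4 * (a + a + u) * N + 4 * c     ≡⟨ distrib (a + a + u) N c ⟩
      4 * ((a + a + u) * N + c)       ≡⟨ cong (4 *_) (fairGame⇒squares a u c fair) ⟩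
      4 * (u * u + c * c)             ≡⟨ 4c²-identity u e ⟩
      quad u + (2 * e + 1) * N + 4 * c ∎)
      where
      open ≡-Reasoning
      distrib : ∀ m n c → 4 * m * n + 4 * c ≡ 4 * (m * n + c)
      distrib = solve-∀

  -- 4 is invertible modulo N, with inverse (c + 1)², since 4 (c + 1)² = (N + 1)².
  squares≋c : ∀ u → N ∣ quad u → u * u + c * c ≋ c
  squares≋c u N∣qu = begin
    X                                             ≈⟨ ≋-sym (+-multiple X (X * (N + 2))) ⟩
    X + X * (N + 2) * N                           ≡⟨ regroup X e ⟩
    4 * X * ((c + 1) * (c + 1))                   ≡⟨ cong (_* ((c + 1) * (c + 1))) (4c²-identity u e) ⟩
    (quad u + (2 * e + 1) * N + 4 * c) * ((c + 1) * (c + 1))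
      ≈⟨ *-cong (+-cong (+-cong (∣⇒≋0 N∣qu) (+-multiple 0 (2 * e + 1))) ≋-refl) ≋-refl ⟩
    4 * c * ((c + 1) * (c + 1))                   ≡⟨ regroup c e ⟨
    c + c * (N + 2) * N                           ≈⟨ +-multiple c (c * (N + 2)) ⟩
    c                                             ∎
    where
    open ≋-Reasoning
    X = u * u + c * c
    regroup : ∀ x e →
      x + x * (2 * (2 + e) + 1 + 2) * (2 * (2 + e) + 1) ≡ 4 * x * ((2 + e + 1) * (2 + e + 1))
    regroup = solve-∀

  v : ℕ → ℕ
  v u = (u * u + c * c) / N

  squares≡ : ∀ u → N ∣ quad u → u * u + c * c ≡ v u * N + c
  squares≡ u N∣qu = begin
    u * u + c * c                                 ≡⟨ m≡m%n+[m/n]*n (u * u + c * c) N ⟩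
    (u * u + c * c) % N + v u * N                 ≡⟨ cong (_+ v u * N) (%-≡-< c<N (squares≋c u N∣qu)) ⟩
    c + v u * N                                   ≡⟨ +-comm c (v u * N) ⟩
    v u * N + c                                   ∎
    where open ≡-Reasoning

  -- If u = v + 1 + w and c = u + t, then u² + c² exceeds v N + c.
  u≤v : ∀ u → u ≤ c → N ∣ quad u → u ≤ v u
  u≤v u u≤c N∣qu with u ≤? v u
  ... | yes u≤vu = u≤vu
  ... | no  u≰vu with m≤n⇒∃[o]m+o≡n (≰⇒> u≰vu) | m≤n⇒∃[o]m+o≡n u≤c
  ...   | w , 1+vu+w≡u | t , u+t≡c =
    ⊥-elim (m+1+n≢m (v u * N + c) (trans (sym (squares-gap (v u) w t 1+vu+w≡u u+t≡c)) (squares≡ u N∣qu)))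

  v<c : ∀ u → u ≤ c → N ∣ quad u → v u < c
  v<c u u≤c N∣qu = ≰⇒> λ c≤vu → <⇒≱ 2c²<cN+c (begin
    c * N + c          ≤⟨ +-monoˡ-≤ c (*-monoˡ-≤ N c≤vu) ⟩
    v u * N + c        ≡⟨ squares≡ u N∣qu ⟨
    u * u + c * c      ≤⟨ +-monoˡ-≤ (c * c) (*-mono-≤ u≤c u≤c) ⟩
    c * c + c * c      ∎)
    where
    open ≤-Reasoning
    identity : ∀ c → c * c + c * c + (c + c) ≡ c * (2 * c + 1) + c
    identity = solve-∀
    2c²<cN+c : c * c + c * c < c * N + c
    2c²<cN+c = subst (c * c + c * c <_) (identity c) (m<m+n (c * c + c * c) z<s)

  -- v N + c = u² + c² and N is odd, so v ≡ u mod 2 because n² ≡ n mod 2.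
  2∣v+u : ∀ u → N ∣ quad u → 2 ∣ v u + u
  2∣v+u u N∣qu = ∣m+n∣m⇒∣n (subst (2 ∣_) regroup (∣m∣n⇒∣m+n (2∣n*[1+n] u) (2∣n*[1+n] c)))
                           (∣m⇒∣m*n (v u * c + c) (∣-refl {2}))
    where
    open ≡-Reasoning
    identity₁ : ∀ u c → u * suc u + c * suc c ≡ u * u + c * c + (u + c)
    identity₁ = solve-∀
    identity₂ : ∀ v u c → v * (2 * c + 1) + c + (u + c) ≡ 2 * (v * c + c) + (v + u)
    identity₂ = solve-∀
    regroup : u * suc u + c * suc c ≡ 2 * (v u * c + c) + (v u + u)
    regroup = begin
      u * suc u + c * suc c        ≡⟨ identity₁ u c ⟩
      u * u + c * c + (u + c)      ≡⟨ cong (_+ (u + c)) (squares≡ u N∣qu) ⟩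
      v u * N + c + (u + c)        ≡⟨ identity₂ (v u) u c ⟩
      2 * (v u * c + c) + (v u + u) ∎

  smallest middle : ℕ → ℕ
  smallest u = (v u ∸ u) / 2
  middle   u = smallest u + u

  smallest-spec : ∀ u → u ≤ c → N ∣ quad u → smallest u + smallest u + u ≡ v u
  smallest-spec u u≤c N∣qu = begin
    smallest u + smallest u + u    ≡⟨ cong (_+ u) (double (smallest u)) ⟩
    smallest u * 2 + u             ≡⟨ cong (_+ u) (m/n*n≡m 2∣v∸u) ⟩
    v u ∸ u + u                    ≡⟨ m∸n+n≡m u≤vu ⟩
    v u                            ∎
    where
    open ≡-Reasoning
    double : ∀ a → a + a ≡ a * 2
    double = solve-∀
    u≤vu = u≤v u u≤c N∣qu
    shuffle : ∀ d u → d + u + u ≡ u * 2 + d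
    shuffle = solve-∀
    2∣v∸u : 2 ∣ v u ∸ u
    2∣v∸u = ∣m+n∣m⇒∣n (subst (2 ∣_) v+u≡ (2∣v+u u N∣qu)) (n∣m*n u)
      where
      v+u≡ : v u + u ≡ u * 2 + (v u ∸ u)
      v+u≡ = trans (cong (_+ u) (sym (m∸n+n≡m u≤vu))) (shuffle (v u ∸ u) u)

  root⇒fairGame : ∀ u → u ≤ c → N ∣ quad u → FairGame (smallest u) (middle u) c
  root⇒fairGame u u≤c N∣qu = squares⇒fairGame (smallest u) u c
    (trans (cong (λ k → k * N + c) (smallest-spec u u≤c N∣qu)) (sym (squares≡ u N∣qu)))

  middle≤c : ∀ u → u ≤ c → N ∣ quad u → middle u ≤ c
  middle≤c u u≤c N∣qu = <⇒≤ (halve (begin-strict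
    middle u + middle u            ≡⟨ regroup (smallest u) u ⟩
    smallest u + smallest u + u + u ≡⟨ cong (_+ u) (smallest-spec u u≤c N∣qu) ⟩
    v u + u                        <⟨ +-mono-<-≤ (v<c u u≤c N∣qu) u≤c ⟩
    c + c                          ∎))
    where
    open ≤-Reasoning
    regroup : ∀ a u → a + u + (a + u) ≡ a + a + u + u
    regroup = solve-∀
    halve : ∀ {m n} → m + m < n + n → m < n
    halve {m} {n} m+m<n+n with m <? n
    ... | yes m<n = m<n
    ... | no  m≮n = ⊥-elim (<⇒≱ m+m<n+n (+-mono-≤ (≮⇒≥ m≮n) (≮⇒≥ m≮n)))

  fairGame⇒smallest : ∀ a u → FairGame a (a + u) c → smallest u ≡ a
  fairGame⇒smallest a u fair = begin
    (v u ∸ u) / 2                  ≡⟨ cong (λ k → (k ∸ u) / 2) v≡ ⟩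
    (a + a + u ∸ u) / 2            ≡⟨ cong (_/ 2) (m+n∸n≡m (a + a) u) ⟩
    (a + a) / 2                    ≡⟨ cong (_/ 2) (double a) ⟩
    a * 2 / 2                      ≡⟨ m*n/n≡m a 2 ⟩
    a                              ∎
    where
    open ≡-Reasoning
    double : ∀ a → a + a ≡ a * 2
    double = solve-∀
    v≡ : v u ≡ a + a + u
    v≡ = begin
      (u * u + c * c) / N                  ≡⟨ cong (_/ N) (fairGame⇒squares a u c fair) ⟨
      ((a + a + u) * N + c) / N            ≡⟨ +-distrib-/-∣ˡ c (n∣m*n (a + a + u)) ⟩
      (a + a + u) * N / N + c / N          ≡⟨ cong₂ _+_ (m*n/n≡m (a + a + u) N) (m<n⇒m/n≡0 c<N) ⟩
      a + a + u + 0                        ≡⟨ +-identityʳ _ ⟩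
      a + a + u                            ∎

  isRootWithMiddle : ℕ → ℕ → Bool
  isRootWithMiddle b u = does ((N ∣? quad u) ×-dec (b ≟ middle u))

  count-fairGames-with-middle : ∀ b → b ≤ c →
    count (λ a → does (fairGame? a b c)) (suc b) ≡ count (isRootWithMiddle b) (suc c)
  count-fairGames-with-middle b b≤c = count-bijection (suc b) (suc c) (b ∸_) smallest to from
    where
    to : ∀ a → a < suc b → does (fairGame? a b c) ≡ true →
         b ∸ a < suc c × isRootWithMiddle b (b ∸ a) ≡ true × smallest (b ∸ a) ≡ a
    to a a<1+b fair? = s≤s (≤-trans (m∸n≤m b a) b≤c)
                     , dec-true ((N ∣? quad u) ×-dec (b ≟ middle u)) (fair⇒root a u fair′ , sym b≡middle)
                     , smallest≡a
      where
      u = b ∸ a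
      a+u≡b : a + u ≡ b
      a+u≡b = m+[n∸m]≡n (≤-pred a<1+b)
      fair′ : FairGame a (a + u) c
      fair′ = subst (λ y → FairGame a y c) (sym a+u≡b) (does≡true⇒ (fairGame? a b c) fair?)
      smallest≡a : smallest u ≡ a
      smallest≡a = fairGame⇒smallest a u fair′
      b≡middle : middle u ≡ b
      b≡middle = trans (cong (_+ u) smallest≡a) a+u≡b
    from : ∀ u → u < suc c → isRootWithMiddle b u ≡ true →
           smallest u < suc b × does (fairGame? (smallest u) b c) ≡ true × b ∸ smallest u ≡ u
    from u u<1+c root? = s≤s (subst (smallest u ≤_) b≡middle (m≤m+n (smallest u) u))
                       , dec-true (fairGame? (smallest u) b c)
                                  (subst (λ y → FairGame (smallest u) y c) b≡middle (root⇒fairGame u (≤-pred u<1+c) N∣qu))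
                       , trans (cong (_∸ smallest u) (sym b≡middle)) (m+n∸m≡n (smallest u) u)
      where
      N∣qu : N ∣ quad u
      N∣qu = proj₁ (does≡true⇒ ((N ∣? quad u) ×-dec (b ≟ middle u)) root?)
      b≡middle : middle u ≡ b
      b≡middle = sym (proj₂ (does≡true⇒ ((N ∣? quad u) ×-dec (b ≟ middle u)) root?))

  count-fairGames : ∑< (suc c) (λ b → count (λ a → does (fairGame? a b c)) (suc b)) ≡
                    count (isRoot N) (suc c)
  count-fairGames = begin
    ∑< (suc c) (λ b → count (λ a → does (fairGame? a b c)) (suc b))
      ≡⟨ ∑<-cong (suc c) (λ b b<1+c → count-fairGames-with-middle b (≤-pred b<1+c)) ⟩
    ∑< (suc c) (λ b → count (isRootWithMiddle b) (suc c))
      ≡⟨ ∑<-comm (suc c) (suc c) (λ b u → indicator (isRootWithMiddle b u)) ⟩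
    ∑< (suc c) (λ u → ∑< (suc c) (λ b → indicator (isRootWithMiddle b u)))
      ≡⟨ ∑<-cong (suc c) column ⟩
    count (isRoot N) (suc c)
      ∎
    where
    open ≡-Reasoning
    column : ∀ u → u < suc c → ∑< (suc c) (λ b → indicator (isRootWithMiddle b u)) ≡ indicator (isRoot N u)
    column u u<1+c = by-cases (N ∣? quad u)
      where
      by-cases : (N∣?qu : Dec (N ∣ quad u)) →
                 ∑< (suc c) (λ b → indicator (does (N∣?qu ×-dec (b ≟ middle u)))) ≡ indicator (does N∣?qu)
      by-cases (no _)     = ∑<-zero (suc c) (λ _ _ → refl)
      by-cases (yes N∣qu) = count-≟ (s≤s (middle≤c u (≤-pred u<1+c) N∣qu))

  #roots≡2*count : #roots N ≡ 2 * count (isRoot N) (suc c)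
  #roots≡2*count = begin
    count (isRoot N) N                                              ≡⟨ cong (count (isRoot N)) N≡1+c+c ⟩
    count (isRoot N) (suc c + c)                                    ≡⟨ ∑<-+-range (suc c) c _ ⟩
    count (isRoot N) (suc c) + count (λ i → isRoot N (suc c + i)) c  ≡⟨ cong (count (isRoot N) (suc c) +_) upper-half ⟩
    count (isRoot N) (suc c) + count (isRoot N) (suc c)             ≡⟨ cong (count (isRoot N) (suc c) +_) (+-identityʳ _) ⟨
    2 * count (isRoot N) (suc c)                                    ∎
    where
    open ≡-Reasoning
    N≡1+c+c : N ≡ suc c + c
    N≡1+c+c = identity c
      where
      identity : ∀ c → 2 * c + 1 ≡ suc c + c
      identity = solve-∀
    N∤3 : ¬ N ∣ 3
    N∤3 N∣3 = <⇒≱ (subst (3 <_) (sym (N≡5+2e e)) (s≤s (s≤s (s≤s (s≤s z≤n))))) (∣⇒≤ N∣3)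
      where
      N≡5+2e : ∀ e → 2 * (2 + e) + 1 ≡ 5 + 2 * e
      N≡5+2e = solve-∀
    upper-half : count (λ i → isRoot N (suc c + i)) c ≡ count (isRoot N) (suc c)
    upper-half = count-bijection c (suc c) (c ∸_) (c ∸_) to from
      where
      to : ∀ i → i < c → isRoot N (suc c + i) ≡ true →
           c ∸ i < suc c × isRoot N (c ∸ i) ≡ true × c ∸ (c ∸ i) ≡ i
      to i i<c root? =
        s≤s (m∸n≤m c i)
        , dec-true (N ∣? quad (c ∸ i)) (root-reflect (suc c + i) (c ∸ i) sum≡N (does≡true⇒ (N ∣? quad (suc c + i)) root?))
        , m∸[m∸n]≡n (<⇒≤ i<c)
        where
        sum≡N : suc c + i + (c ∸ i) ≡ N
        sum≡N = trans (+-assoc (suc c) i (c ∸ i))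
                      (trans (cong (suc c +_) (m+[n∸m]≡n (<⇒≤ i<c))) (sym N≡1+c+c))
      from : ∀ u → u < suc c → isRoot N u ≡ true →
             c ∸ u < c × isRoot N (suc c + (c ∸ u)) ≡ true × c ∸ (c ∸ u) ≡ u
      from zero    _     root? = ⊥-elim (N∤3 (does≡true⇒ (N ∣? 3) root?))
      from (suc u) u<1+c root? =
        ∸-monoʳ-< z<s (≤-pred u<1+c)
        , dec-true (N ∣? quad (suc c + (c ∸ suc u)))
                   (root-reflect (suc u) (suc c + (c ∸ suc u)) sum≡N (does≡true⇒ (N ∣? quad (suc u)) root?))
        , m∸[m∸n]≡n (≤-pred u<1+c)
        where
        sum≡N : suc u + (suc c + (c ∸ suc u)) ≡ N
        sum≡N = trans (shuffle (suc u) (suc c) (c ∸ suc u))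
                      (trans (cong (suc c +_) (m+[n∸m]≡n (≤-pred u<1+c))) (sym N≡1+c+c))
          where
          shuffle : ∀ a b d → a + (b + d) ≡ b + (a + d)
          shuffle = solve-∀

  root-of-fairGame : ∀ {x₁ x₂ x₃} → FairGame x₁ x₂ x₃ → c ≡ x₁ ⊎ c ≡ x₂ ⊎ c ≡ x₃ → ∃ λ u → N ∣ quad u
  root-of-fairGame fair c∈game with fairGame-moveLast fair c∈game
  ... | x , y , fair′ with ≤-total x y
  ...   | inj₁ x≤y = y ∸ x , fair⇒root x (y ∸ x) (subst (λ z → FairGame x z c) (sym (m+[n∸m]≡n x≤y)) fair′)
  ...   | inj₂ y≤x = x ∸ y , fair⇒root y (x ∸ y) (subst (λ z → FairGame y z c) (sym (m+[n∸m]≡n y≤x))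
                                                         (fairGame-swap {x} fair′))

numFairGamesWithMax≡∑ : ∀ c → numFairGamesWithMax c ≡ ∑< (suc c) (λ b → count (λ a → does (fairGame? a b c)) (suc b))
numFairGamesWithMax≡∑ c =
  trans (length-filter-concatMap P? (λ b → map (_, b) (upTo (suc b))) id (suc c))
        (∑<-cong (suc c) (λ b _ → trans (length-filter-map P? (_, b) (upTo (suc b)))
                                         (length-filter-applyUpTo (λ a → fairGame? a b c) id (suc b))))
  where
  P? : ∀ p → Dec (FairGame (proj₁ p) (proj₂ p) c)
  P? (a , b) = fairGame? a b c

theorem5p5 : (c : ℕ) → 1 < c →
    ∃ (λ x₁ → ∃ (λ x₂ → ∃ (λ x₃ → FairGame x₁ x₂ x₃ × (c ≡ x₁ ⊎ c ≡ x₂ ⊎ c ≡ x₃)))) →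
    2 * numFairGamesWithMax c ≡ 2 ^ numPrimeFactorsNot3 (2 * c + 1)
theorem5p5 (suc zero) (s≤s ()) _
theorem5p5 c@(suc (suc e)) _ (_ , _ , _ , fair , c∈game) = begin
  2 * numFairGamesWithMax c          ≡⟨ cong (2 *_) (trans (numFairGamesWithMax≡∑ c) count-fairGames) ⟩
  2 * count (isRoot N) (suc c)       ≡⟨ #roots≡2*count ⟨
  #roots N                           ≡⟨ #roots≡2^numPrimeFactorsNot3 N (root-of-fairGame fair c∈game) ⟩
  2 ^ numPrimeFactorsNot3 N          ∎
  where
  open ≡-Reasoning
  open GamesWithMax e using (N; count-fairGames; #roots≡2*count; root-of-fairGame)
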